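{- Consider a BFOP instance with Boolean variables $x_1,\dots,x_n$ and functions $f_1,\dots,f_m$ with weights, where each $f_i:\{0,1\}^2\to\mathbb{R}$ is applied to a pair of distinct variables. Let $\gamma\in\{0,1\}^n$ be an initial assignment and $H$ a sequence of variable flips. Define the matrix $M_{H,\gamma}$ with one row for each nonseparable function $f_i$ and one column for each arc of $H$, where the column of an arc is $\delta_1+\delta_2$ restricted to the nonseparable functions, $\delta_1,\delta_2$ being the change vectors of the two flips forming the arc. Then the entry of $M_{H,\gamma}$ at the row of a nonseparable function $f_i$ and the column of an arc $\alpha$ of a variable $x_j$ is nonzero if and only if $x_j$ is one of the variables of $f_i$ and the other variable $x_k$ of $f_i$ is flipped an odd number of times strictly between the two flips of $\alpha$.
   Context: When a variable is flipped, the change vector $\delta$ is indexed by the functions, with $\delta_i$ equal to the value of $f_i$ after the flip minus its value before the flip (so the change of the objective $\sum_i w_if_i$ is $\langle\delta,w\rangle$). An arc of $H$ is a pair of consecutive flips of the same variable. A function $f$ of two Boolean arguments is separable if $f(x,y)=f'(x)+f''(y)$ for some unary functions $f',f''$, and nonseparable otherwise. -}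

module Defs where

open import Level using (Level; _⊔_)
open import Algebra.Bundles using (CommutativeRing)
open import Data.Bool using (Bool; not; if_then_else_)
open import Data.Nat using (ℕ; suc; _%_)
open import Data.Fin using (Fin; toℕ; _<_)
open import Data.Fin.Properties using (_≟_)
open import Data.List using (List; length; take; drop; filter; lookup; foldl)
open import Data.Product using (Σ; _×_)
open import Data.Sum using (_⊎_)
open import Relation.Nullary using (¬_; does)
open import Relation.Binary.PropositionalEquality using (_≡_; _≢_)

-- A BFOP instance on n Boolean variables with m weighted binary functions,
-- valued in a commutative ring R (the paper uses ℝ).
-- Function i is f_i(x_{var₁ i}, x_{var₂ i}) with var₁ i ≠ var₂ i.
record BFOP {c ℓ : Level} (R : CommutativeRing c ℓ) (n m : ℕ) : Set c where
  open CommutativeRing R using (Carrier)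
  field
    var₁     : Fin m → Fin n
    var₂     : Fin m → Fin n
    distinct : (i : Fin m) → var₁ i ≢ var₂ i
    fn       : Fin m → Bool → Bool → Carrier
    weight   : Fin m → Carrier

Assignment : ℕ → Set
Assignment n = Fin n → Bool

flipVar : {n : ℕ} → Assignment n → Fin n → Assignment n
flipVar σ j k = if does (k ≟ j) then not (σ k) else σ k

applyFlips : {n : ℕ} → Assignment n → List (Fin n) → Assignment n
applyFlips = foldl flipVar

-- a flip sequence H is a list of variables; positions are Fin (length H)
-- assignment just before / just after the flip at position p
before : {n : ℕ} (γ : Assignment n) (H : List (Fin n)) → Fin (length H) → Assignment n
before γ H p = applyFlips γ (take (toℕ p) H)

after : {n : ℕ} (γ : Assignment n) (H : List (Fin n)) → Fin (length H) → Assignment n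
after γ H p = applyFlips γ (take (suc (toℕ p)) H)

module _ {c ℓ : Level} {R : CommutativeRing c ℓ} {n m : ℕ} where
  open CommutativeRing R

  value : BFOP R n m → Fin m → Assignment n → Carrier
  value I i σ = BFOP.fn I i (σ (BFOP.var₁ I i)) (σ (BFOP.var₂ I i))

  δ : BFOP R n m → Assignment n → (H : List (Fin n)) → Fin (length H) → Fin m → Carrier
  δ I γ H p i = value I i (after γ H p) - value I i (before γ H p)

  Separable : BFOP R n m → Fin m → Set (c ⊔ ℓ)
  Separable I i = Σ (Bool → Carrier) λ f′ → Σ (Bool → Carrier) λ f″ →
    ∀ x y → BFOP.fn I i x y ≈ f′ x + f″ y

  Nonseparable : BFOP R n m → Fin m → Set (c ⊔ ℓ)
  Nonseparable I i = ¬ Separable I i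

  -- entry of M_{H,γ} at row i (nonseparable) and column of arc (s,t)
  entry : BFOP R n m → Assignment n → (H : List (Fin n)) →
          Fin m → Fin (length H) → Fin (length H) → Carrier
  entry I γ H i s t = δ I γ H s i + δ I γ H t i

IsArc : {n : ℕ} (H : List (Fin n)) → Fin (length H) → Fin (length H) → Set
IsArc H s t = (s < t) × (lookup H s ≡ lookup H t) ×
  ((p : Fin (length H)) → s < p → p < t → lookup H p ≢ lookup H s)

flipsBetween : {n : ℕ} (H : List (Fin n)) → Fin (length H) → Fin (length H) → Fin n → ℕ
flipsBetween H s t k = length (filter (_≟ k) (drop (suc (toℕ s)) (take (toℕ t) H)))

Odd : ℕ → Set
Odd k = k % 2 ≡ 1

module Submission where

-- Lemma 5.3.  Write f_i = F(a , b) and let (s , t) be an arc of x.  The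
-- entry is the sum of the changes of F at the two flips of x.
--   * If x ∉ {a , b}, neither flip changes F, so the entry is 0.
--   * If x = a, the assignments around the arc look, at (a , b), like
--       (X , Y) → (¬X , Y) → (¬X , Y′) → (X , Y′),
--     where Y′ is Y flipped once per flip of b inside the arc.  This "arc
--     contribution" of F is 0 when Y′ = Y and, when Y′ = ¬Y, is ± the mixed
--     difference F(0,0)+F(1,1)-F(0,1)-F(1,0), which vanishes only for
--     separable F.
--   * The case x = b is the case x = a for the instance with the arguments
--     of every function swapped, which has the same entries.

open import Defs
open import Level using (Level)
open import Algebra.Bundles using (CommutativeRing)
open import Data.Nat using (ℕ)
open import Data.Fin using (Fin)
open import Data.List using (List; length; lookup)
open import Data.Product using (_×_)
open import Data.Sum using (_⊎_)
open import Relation.Nullary using (¬_)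
open import Relation.Binary.PropositionalEquality using (_≡_)
open import Function.Bundles using (_⇔_)

open import Data.Bool using (Bool; true; false; not)
open import Data.Bool.Properties using (not-involutive)
open import Data.Empty using (⊥-elim)
open import Data.Fin using (toℕ) renaming (zero to fzero; suc to fsuc)
open import Data.Fin.Properties using (_≟_)
open import Data.List using ([]; _∷_; _++_; take; drop; filter)
open import Data.List.Properties
  using (take-suc; foldl-∷ʳ; foldl-++; take++drop≡id; take-take; filter-none)
open import Data.List.Relation.Unary.All using (All; []; _∷_)
open import Data.List.Relation.Unary.All.Properties using (drop⁺)
open import Data.Maybe using (nothing)
open import Data.Nat using (zero; suc; _≤_; z≤n; s≤s) renaming (_<_ to _<ℕ_)
open import Data.Nat.Properties using (m≤n⇒m⊓n≡m)
open import Data.Product using (Σ; _,_)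
open import Data.Sum using (inj₁; inj₂)
open import Function using (_∘′_)
open import Function.Bundles using (Equivalence; mk⇔)
open import Relation.Nullary using (yes; no)
open import Relation.Binary.PropositionalEquality
  using (_≢_; refl; sym; trans; cong; cong₂; cong-app; subst; module ≡-Reasoning)
open import Tactic.RingSolver.Core.AlmostCommutativeRing using (fromCommutativeRing)

flipN : ℕ → Bool → Bool
flipN zero    b = b
flipN (suc c) b = not (flipN c b)

flipN-not : ∀ c b → flipN c (not b) ≡ not (flipN c b)
flipN-not zero    b = refl
flipN-not (suc c) b = cong not (flipN-not c b)

flipN-parity : ∀ c b → (Odd c × flipN c b ≡ not b) ⊎ (¬ Odd c × flipN c b ≡ b)
flipN-parity zero          b = inj₂ ((λ ()) , refl)
flipN-parity (suc zero)    b = inj₁ (refl , refl)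
flipN-parity (suc (suc c)) b with flipN-parity c b
... | inj₁ (odd , e)  = inj₁ (odd , trans (not-involutive _) e)
... | inj₂ (even , e) = inj₂ (even , trans (not-involutive _) e)

flipVar-hit : {n : ℕ} (σ : Assignment n) {j k : Fin n} → j ≡ k → flipVar σ j k ≡ not (σ k)
flipVar-hit σ {j} {k} j≡k with k ≟ j
... | yes _   = refl
... | no  k≢j = ⊥-elim (k≢j (sym j≡k))

flipVar-miss : {n : ℕ} (σ : Assignment n) {j k : Fin n} → j ≢ k → flipVar σ j k ≡ σ k
flipVar-miss σ {j} {k} j≢k with k ≟ j
... | yes k≡j = ⊥-elim (j≢k (sym k≡j))
... | no  _   = refl

count : {n : ℕ} → Fin n → List (Fin n) → ℕ
count k l = length (filter (_≟ k) l)

applyFlips-count : {n : ℕ} (σ : Assignment n) (l : List (Fin n)) (k : Fin n) →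
  applyFlips σ l k ≡ flipN (count k l) (σ k)
applyFlips-count σ []      k = refl
applyFlips-count σ (j ∷ l) k with j ≟ k
... | yes j≡k = begin
  applyFlips (flipVar σ j) l k      ≡⟨ applyFlips-count (flipVar σ j) l k ⟩
  flipN (count k l) (flipVar σ j k) ≡⟨ cong (flipN (count k l)) (flipVar-hit σ j≡k) ⟩
  flipN (count k l) (not (σ k))     ≡⟨ flipN-not (count k l) (σ k) ⟩
  not (flipN (count k l) (σ k))     ∎
  where open ≡-Reasoning
... | no j≢k = trans (applyFlips-count (flipVar σ j) l k)
                     (cong (flipN (count k l)) (flipVar-miss σ j≢k))

after-flip : {n : ℕ} (γ : Assignment n) (H : List (Fin n)) (p : Fin (length H)) →
  after γ H p ≡ flipVar (before γ H p) (lookup H p)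
after-flip γ H p = trans (cong (applyFlips γ) (take-suc H p))
                         (foldl-∷ʳ flipVar γ (lookup H p) (take (toℕ p) H))

after-hit : {n : ℕ} (γ : Assignment n) (H : List (Fin n)) (p : Fin (length H)) {k : Fin n} →
  lookup H p ≡ k → after γ H p k ≡ not (before γ H p k)
after-hit γ H p ≡k = trans (cong-app (after-flip γ H p) _) (flipVar-hit (before γ H p) ≡k)

after-miss : {n : ℕ} (γ : Assignment n) (H : List (Fin n)) (p : Fin (length H)) {k : Fin n} →
  lookup H p ≢ k → after γ H p k ≡ before γ H p k
after-miss γ H p ≢k = trans (cong-app (after-flip γ H p) _) (flipVar-miss (before γ H p) ≢k)

take-split : {A : Set} (H : List A) (s t : ℕ) → s <ℕ t →
  take t H ≡ take (suc s) H ++ drop (suc s) (take t H)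
take-split H s t s<t = begin
  take t H                                                ≡⟨ take++drop≡id (suc s) (take t H) ⟨
  take (suc s) (take t H) ++ drop (suc s) (take t H)      ≡⟨ cong (_++ drop (suc s) (take t H)) take-prefix ⟩
  take (suc s) H ++ drop (suc s) (take t H)               ∎
  where
  open ≡-Reasoning
  take-prefix : take (suc s) (take t H) ≡ take (suc s) H
  take-prefix = trans (take-take (suc s) t H) (cong (λ r → take r H) (m≤n⇒m⊓n≡m s<t))

before-later : {n : ℕ} (γ : Assignment n) (H : List (Fin n)) (s t : Fin (length H)) →
  toℕ s <ℕ toℕ t → (k : Fin n) →
  before γ H t k ≡ flipN (flipsBetween H s t k) (after γ H s k)
before-later γ H s t s<t k = begin
  applyFlips γ (take (toℕ t) H) k                                        ≡⟨ cong (λ l → applyFlips γ l k) (take-split H (toℕ s) (toℕ t) s<t) ⟩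
  applyFlips γ (take (suc (toℕ s)) H ++ segment) k                       ≡⟨ cong-app (foldl-++ flipVar γ (take (suc (toℕ s)) H) segment) k ⟩
  applyFlips (after γ H s) segment k                                     ≡⟨ applyFlips-count (after γ H s) segment k ⟩
  flipN (flipsBetween H s t k) (after γ H s k)                           ∎
  where
  open ≡-Reasoning
  segment = drop (suc (toℕ s)) (take (toℕ t) H)

segment-All : {A : Set} (Q : A → Set) (H : List A) (a t : ℕ) →
  ((p : Fin (length H)) → a ≤ toℕ p → toℕ p <ℕ t → Q (lookup H p)) →
  All Q (drop a (take t H))
segment-All Q H       a       zero    h = drop⁺ a []
segment-All Q []      a       (suc t) h = drop⁺ a []
segment-All Q (x ∷ H) zero    (suc t) h =
  h fzero z≤n (s≤s z≤n) ∷ segment-All Q H zero t (λ p _ p<t → h (fsuc p) z≤n (s≤s p<t))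
segment-All Q (x ∷ H) (suc a) (suc t) h =
  segment-All Q H a t (λ p a≤p p<t → h (fsuc p) (s≤s a≤p) (s≤s p<t))

arc-variable-unflipped : {n : ℕ} (H : List (Fin n)) (s t : Fin (length H)) → IsArc H s t →
  flipsBetween H s t (lookup H s) ≡ 0
arc-variable-unflipped H s t (_ , _ , inside) =
  cong length (filter-none (_≟ lookup H s)
    (segment-All _ H (suc (toℕ s)) (toℕ t) inside))

module BinaryFunction {c ℓ : Level} (R : CommutativeRing c ℓ) where
  open CommutativeRing R renaming (refl to ≈-refl; sym to ≈-sym; trans to ≈-trans)
  open import Algebra.Properties.AbelianGroup +-abelianGroup using (x∙y⁻¹≈ε⇒x≈y; x≈y⇒x∙y⁻¹≈ε; xyx⁻¹≈y)
  open import Relation.Binary.Reasoning.Setoid setoid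
  open import Tactic.RingSolver.NonReflective (fromCommutativeRing R (λ _ → nothing))

  Balanced : (Bool → Bool → Carrier) → Set ℓ
  Balanced F = F false false + F true true ≈ F false true + F true false

  regroup : ∀ p q r u → (p - q) + (r - u) ≈ (p + r) - (q + u)
  regroup = solve 4 (λ p q r u → ((p ⊕ (⊝ q)) ⊕ (r ⊕ (⊝ u))) ⊜ ((p ⊕ r) ⊕ (⊝ (q ⊕ u)))) ≈-refl

  plus-minus : ∀ u v w → u + (v - w) ≈ (u + v) - w
  plus-minus = solve 3 (λ u v w → (u ⊕ (v ⊕ (⊝ w))) ⊜ ((u ⊕ v) ⊕ (⊝ w))) ≈-refl

  balanced⇒separable : (F : Bool → Bool → Carrier) → Balanced F →
    Σ (Bool → Carrier) λ f′ → Σ (Bool → Carrier) λ f″ → ∀ x y → F x y ≈ f′ x + f″ y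
  balanced⇒separable F bal = (λ x → F x false) , (λ y → F false y - F false false) , split
    where
    split : ∀ x y → F x y ≈ F x false + (F false y - F false false)
    split x false = ≈-sym (≈-trans (+-congˡ (-‿inverseʳ _)) (+-identityʳ _))
    split false true = ≈-sym (≈-trans (plus-minus _ _ _) (xyx⁻¹≈y _ _))
    split true true = begin
      F true true                                     ≈⟨ xyx⁻¹≈y (F false false) (F true true) ⟨
      (F false false + F true true) - F false false   ≈⟨ +-congʳ bal ⟩
      (F false true + F true false) - F false false   ≈⟨ +-congʳ (+-comm _ _) ⟩
      (F true false + F false true) - F false false   ≈⟨ plus-minus _ _ _ ⟨
      F true false + (F false true - F false false)   ∎

  -- Sum of the changes of F along (X,Y) → (¬X,Y) and (¬X,Y′) → (X,Y′):
  -- the entry of an arc of the first argument of F.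
  contribution : (Bool → Bool → Carrier) → Bool → Bool → Bool → Carrier
  contribution F X Y Y′ = (F (not X) Y - F X Y) + (F X Y′ - F (not X) Y′)

  contribution-unchanged : ∀ F X Y → contribution F X Y Y ≈ 0#
  contribution-unchanged F X Y =
    ≈-trans (regroup _ _ _ _) (x≈y⇒x∙y⁻¹≈ε (+-comm (F (not X) Y) (F X Y)))

  -- If the second argument has changed, the contribution is the mixed second
  -- difference up to sign, hence nonzero for an unbalanced function.
  contribution-flipped : ∀ F → ¬ Balanced F → ∀ X Y → ¬ (contribution F X Y (not Y) ≈ 0#)
  contribution-flipped F unbal X Y vanishes = unbal (balanced X Y square)
    where
    square : F (not X) Y + F X (not Y) ≈ F X Y + F (not X) (not Y)
    square = x∙y⁻¹≈ε⇒x≈y _ _ (≈-trans (≈-sym (regroup _ _ _ _)) vanishes)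
    balanced : ∀ X Y → F (not X) Y + F X (not Y) ≈ F X Y + F (not X) (not Y) → Balanced F
    balanced false false sq = ≈-trans (≈-sym sq) (+-comm _ _)
    balanced true  false sq = ≈-trans sq (+-comm _ _)
    balanced false true  sq = ≈-trans (+-comm _ _) sq
    balanced true  true  sq = ≈-trans (+-comm _ _) (≈-sym sq)

  contribution-nonzero⇔odd : ∀ F → ¬ Balanced F → ∀ k X Y →
    (¬ (contribution F X Y (flipN k Y) ≈ 0#)) ⇔ Odd k
  contribution-nonzero⇔odd F unbal k X Y with flipN-parity k Y
  ... | inj₁ (odd , e) rewrite e =
    mk⇔ (λ _ → odd) (λ _ → contribution-flipped F unbal X Y)
  ... | inj₂ (even , e) rewrite e =
    mk⇔ (λ nonzero → ⊥-elim (nonzero (contribution-unchanged F X Y))) (λ odd → ⊥-elim (even odd))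

-- The instance with the two arguments of every function swapped; it has the
-- same values, hence the same matrix entries, as I.
transpose : {c ℓ : Level} {R : CommutativeRing c ℓ} {n m : ℕ} → BFOP R n m → BFOP R n m
transpose I = record
  { var₁     = BFOP.var₂ I
  ; var₂     = BFOP.var₁ I
  ; distinct = λ i e → BFOP.distinct I i (sym e)
  ; fn       = λ i x y → BFOP.fn I i y x
  ; weight   = BFOP.weight I
  }

transpose-nonseparable : {c ℓ : Level} {R : CommutativeRing c ℓ} {n m : ℕ}
  (I : BFOP R n m) (i : Fin m) → Nonseparable I i → Nonseparable (transpose I) i
transpose-nonseparable {R = R} I i nonsep (f′ , f″ , h) =
  nonsep (f″ , f′ , λ x y → CommutativeRing.trans R (h y x) (CommutativeRing.+-comm R _ _))

module ArcEntry {c ℓ : Level} (R : CommutativeRing c ℓ) {n m : ℕ}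
  (I : BFOP R n m) (γ : Assignment n) (H : List (Fin n)) (i : Fin m) where
  open CommutativeRing R renaming (refl to ≈-refl; sym to ≈-sym; trans to ≈-trans)
  open BinaryFunction R
  open BFOP I

  δ-outside : (p : Fin (length H)) → lookup H p ≢ var₁ i → lookup H p ≢ var₂ i →
    δ I γ H p i ≈ 0#
  δ-outside p ≢a ≢b = begin
    value I i (after γ H p) - value I i (before γ H p)  ≡⟨ cong (λ v → v - value I i (before γ H p)) unchanged ⟩
    value I i (before γ H p) - value I i (before γ H p) ≈⟨ -‿inverseʳ _ ⟩
    0#                                                  ∎
    where
    open import Relation.Binary.Reasoning.Setoid setoid
    unchanged : value I i (after γ H p) ≡ value I i (before γ H p)
    unchanged = cong₂ (fn i) (after-miss γ H p ≢a) (after-miss γ H p ≢b)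

  entry-outside : (s t : Fin (length H)) → IsArc H s t →
    lookup H s ≢ var₁ i → lookup H s ≢ var₂ i → entry I γ H i s t ≈ 0#
  entry-outside s t (_ , s≡t , _) ≢a ≢b =
    ≈-trans (+-cong (δ-outside s ≢a ≢b) (δ-outside t (≢a ∘′ trans s≡t) (≢b ∘′ trans s≡t)))
          (+-identityʳ 0#)

  entry-first-variable : (s t : Fin (length H)) → IsArc H s t → lookup H s ≡ var₁ i →
    entry I γ H i s t ≡
      contribution (fn i) (before γ H s (var₁ i)) (before γ H s (var₂ i))
                   (flipN (flipsBetween H s t (var₂ i)) (before γ H s (var₂ i)))
  entry-first-variable s t arc@(s<t , s≡t , _) x≡a =
    cong₂ _+_ (cong (_- value I i (before γ H s)) (cong₂ (fn i) after-s-a after-s-b))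
              (cong₂ _-_ (cong₂ (fn i) after-t-a after-t-b) (cong₂ (fn i) before-t-a before-t-b))
    where
    a = var₁ i
    b = var₂ i
    x≢b : lookup H s ≢ b
    x≢b x≡b = distinct i (trans (sym x≡a) x≡b)
    after-s-a : after γ H s a ≡ not (before γ H s a)
    after-s-a = after-hit γ H s x≡a
    after-s-b : after γ H s b ≡ before γ H s b
    after-s-b = after-miss γ H s x≢b
    before-t-a : before γ H t a ≡ not (before γ H s a)
    before-t-a = begin
      before γ H t a                                 ≡⟨ before-later γ H s t s<t a ⟩
      flipN (flipsBetween H s t a) (after γ H s a)   ≡⟨ cong (λ v → flipN (flipsBetween H s t v) (after γ H s a)) x≡a ⟨
      flipN (flipsBetween H s t (lookup H s)) _      ≡⟨ cong (λ r → flipN r (after γ H s a)) (arc-variable-unflipped H s t arc) ⟩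
      after γ H s a                                  ≡⟨ after-s-a ⟩
      not (before γ H s a)                           ∎
      where open ≡-Reasoning
    before-t-b : before γ H t b ≡ flipN (flipsBetween H s t b) (before γ H s b)
    before-t-b = trans (before-later γ H s t s<t b) (cong (flipN (flipsBetween H s t b)) after-s-b)
    after-t-a : after γ H t a ≡ before γ H s a
    after-t-a = trans (after-hit γ H t (trans (sym s≡t) x≡a))
                      (trans (cong not before-t-a) (not-involutive _))
    after-t-b : after γ H t b ≡ flipN (flipsBetween H s t b) (before γ H s b)
    after-t-b = trans (after-miss γ H t (λ t≡b → x≢b (trans s≡t t≡b))) before-t-b

  entry-first-variable⇔ : Nonseparable I i → (s t : Fin (length H)) → IsArc H s t →
    lookup H s ≡ var₁ i →
    (¬ (entry I γ H i s t ≈ 0#)) ⇔ Odd (flipsBetween H s t (var₂ i))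
  entry-first-variable⇔ nonsep s t arc x≡a =
    subst (λ e → (¬ (e ≈ 0#)) ⇔ Odd (flipsBetween H s t (var₂ i)))
          (sym (entry-first-variable s t arc x≡a))
          (contribution-nonzero⇔odd (fn i) (nonsep ∘′ balanced⇒separable (fn i))
            (flipsBetween H s t (var₂ i)) (before γ H s (var₁ i)) (before γ H s (var₂ i)))

⇔-first : {a b c d e : Level} {A : Set a} {P : Set b} {Q : Set c} {B : Set d} {C : Set e} →
  P → ¬ Q → A ⇔ B → A ⇔ ((P × B) ⊎ (Q × C))
⇔-first p ¬q A⇔B =
  mk⇔ (λ a → inj₁ (p , Equivalence.to A⇔B a))
      λ { (inj₁ (_ , b)) → Equivalence.from A⇔B b ; (inj₂ (q , _)) → ⊥-elim (¬q q) }

⇔-second : {a b c d e : Level} {A : Set a} {P : Set b} {Q : Set c} {B : Set d} {C : Set e} →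
  ¬ P → Q → A ⇔ C → A ⇔ ((P × B) ⊎ (Q × C))
⇔-second ¬p q A⇔C =
  mk⇔ (λ a → inj₂ (q , Equivalence.to A⇔C a))
      λ { (inj₁ (p , _)) → ⊥-elim (¬p p) ; (inj₂ (_ , c)) → Equivalence.from A⇔C c }

⇔-neither : {a b c d e : Level} {A : Set a} {P : Set b} {Q : Set c} {B : Set d} {C : Set e} →
  ¬ A → ¬ P → ¬ Q → A ⇔ ((P × B) ⊎ (Q × C))
⇔-neither ¬a ¬p ¬q =
  mk⇔ (λ a → ⊥-elim (¬a a)) λ { (inj₁ (p , _)) → ⊥-elim (¬p p) ; (inj₂ (q , _)) → ⊥-elim (¬q q) }

lemma5p3 : {c ℓ : Level} (R : CommutativeRing c ℓ) {n m : ℕ}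
    (I : BFOP R n m) (γ : Assignment n) (H : List (Fin n))
    (i : Fin m) → Nonseparable I i →
    (s t : Fin (length H)) → IsArc H s t →
    (¬ (CommutativeRing._≈_ R (entry I γ H i s t) (CommutativeRing.0# R)))
      ⇔ ((lookup H s ≡ BFOP.var₁ I i × Odd (flipsBetween H s t (BFOP.var₂ I i)))
         ⊎ (lookup H s ≡ BFOP.var₂ I i × Odd (flipsBetween H s t (BFOP.var₁ I i))))
lemma5p3 R I γ H i nonsep s t arc
  with lookup H s ≟ BFOP.var₁ I i | lookup H s ≟ BFOP.var₂ I i
... | yes x≡a | _ =
  ⇔-first x≡a (λ x≡b → BFOP.distinct I i (trans (sym x≡a) x≡b))
    (ArcEntry.entry-first-variable⇔ R I γ H i nonsep s t arc x≡a)
... | no x≢a | yes x≡b =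
  ⇔-second x≢a x≡b
    (ArcEntry.entry-first-variable⇔ R (transpose I) γ H i
      (transpose-nonseparable I i nonsep) s t arc x≡b)
... | no x≢a | no x≢b =
  ⇔-neither (λ nonzero → nonzero (ArcEntry.entry-outside R I γ H i s t arc x≢a x≢b)) x≢a x≢b
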